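{- Let $G=(V,E)$ be a directed graph with $V=\omega$ that is locally finite, i.e. $|N^+(v)|$ is finite for every $v\in V$. Then $G$ is dangerous if and only if $G$ contains a directed cycle.
   Context: A directed graph is a pair $G=(V,E)$ with $V$ a set and $E\subseteq V^2$. For $v\in V$, $N^+(v)=\{w\in V:(v,w)\in E\}$. A directed cycle is a sequence of distinct vertices $v_1,\dots,v_n$ ($n\ge 1$) with $(v_i,v_{i+1})\in E$ for $i<n$ and $(v_n,v_1)\in E$. For $\alpha\in 2^V$ and $I\subseteq V$, let $\alpha^I=\{\beta\in 2^V:\beta(x)=\alpha(x)\text{ for all }x\in V\setminus I\}$. A function $g:2^V\to 2$ is independent of $I\subseteq V$ if $g$ is constant on $\alpha^I$ for every $\alpha\in 2^V$. A function $f:2^V\to 2^V$ respects $G$ if for every $v\in V$ the function $f^v(x)=f(x)(v)$ is independent of $V\setminus N^+(v)$. $\mathfrak{R}(G)$ is the set of all $f:2^V\to 2^V$ respecting $G$. The graph $G$ is dangerous if $\mathfrak{R}(G)$ contains a function with no fixed point. -}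

module Defs where

open import Data.Nat using (ℕ; suc)
open import Data.Bool using (Bool)
open import Data.Fin using (Fin; zero; suc; inject₁; fromℕ)
open import Data.List using (List)
open import Data.List.Membership.Propositional using (_∈_)
open import Data.Product using (Σ; _×_)
open import Function using (_⇔_)
open import Function.Definitions using (Injective)
open import Relation.Nullary using (¬_)
open import Relation.Binary.PropositionalEquality using (_≡_)

Graph : Set₁
Graph = ℕ → ℕ → Set

Config : Set
Config = ℕ → Bool

LocallyFinite : Graph → Set
LocallyFinite E = ∀ v → Σ (List ℕ) λ l → ∀ w → (E v w ⇔ w ∈ l)

-- f respects G: for every v, f^v(x) = f(x)(v) is independent of V ∖ N⁺(v),
-- i.e. constant on α^(V∖N⁺(v)) = {β | β agrees with α on N⁺(v)}.
Respects : Graph → (Config → Config) → Set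
Respects E f = ∀ v (α β : Config) → (∀ x → E v x → α x ≡ β x) → f α v ≡ f β v

FixedPoint : (Config → Config) → Config → Set
FixedPoint f α = ∀ x → f α x ≡ α x

Dangerous : Graph → Set
Dangerous E = Σ (Config → Config) λ f → Respects E f × ¬ (Σ Config λ α → FixedPoint f α)

HasDirectedCycle : Graph → Set
HasDirectedCycle E =
  Σ ℕ λ n → Σ (Fin (suc n) → ℕ) λ vs →
    Injective _≡_ _≡_ vs
    × (∀ (i : Fin n) → E (vs (inject₁ i)) (vs (suc i)))
    × E (vs (fromℕ n)) (vs zero)

-- A cycle v₀ → ⋯ → vₙ → v₀ is dangerous: let each vᵢ copy the value of its successor, except vₙ,
-- which negates the value of v₀; around the cycle a fixed point would give x = not x.
--
-- Conversely, let E be acyclic and f respect E. Truncate f to the vertices below M and iterate it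
-- from the all-false configuration: a vertex whose value changes at step t + 1 has an out-neighbour
-- whose value changes at step t, so a change at step M would give a walk through M + 1 vertices
-- below M, which repeats a vertex and so contains a cycle. Hence f has a fixed point on [0, M) for
-- every M. By weak König's lemma some α has every finite prefix extendable to such a partial fixed
-- point for every M, and since f α v only depends on the finitely many out-neighbours of v, α is a
-- fixed point of f.
module Submission where

open import Defs
open import Level using (0ℓ)
open import Axiom.ExcludedMiddle using (ExcludedMiddle)
open import Axiom.DoubleNegationElimination using (em⇒dne)
open import Function using (_⇔_; _∘_; Injective)
open import Function.Bundles using (mk⇔; Equivalence)
open import Data.Nat using (ℕ; zero; suc; _+_; _<_; _≤_; _⊔_; s≤s; s≤s⁻¹; _≟_; _<?_)
open import Data.Nat.Properties
open import Data.Nat.GeneralisedArithmetic using (fold)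
open import Data.Nat.Induction using (<-rec)
open import Data.Bool using (Bool; true; false; not)
open import Data.Bool.Properties using (not-¬) renaming (_≟_ to _≟ᵇ_)
open import Data.Fin using (Fin; zero; suc; inject₁; fromℕ; toℕ; fromℕ<)
open import Data.Fin.Properties
  using (any?; pigeonhole; toℕ-injective; toℕ<n; toℕ≤pred[n]; toℕ-inject₁; toℕ-fromℕ; toℕ-fromℕ<)
open import Data.Fin.Relation.Unary.Top using (View; ‵fromℕ; ‵inject₁; view; view-fromℕ; view-inject₁)
open import Data.List.Extrema.Nat using (max; v≤max⁺; xs≤max)
import Data.List.Relation.Unary.All as All
open import Data.Product using (Σ; _×_; _,_; proj₁; proj₂)
open import Data.Sum using (inj₁; inj₂)
open import Data.List using (List)
open import Data.Empty using (⊥-elim)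
open import Relation.Nullary using (¬_; yes; no)
open import Relation.Nullary.Decidable using (decidable-stable)
open import Relation.Binary.Definitions using (tri<; tri≈; tri>)
open import Relation.Binary.PropositionalEquality

private
  ∅ : Config
  ∅ _ = false

shift-invariant⇒constant : ∀ {A : Set} {n} (h : Fin (suc n) → A) →
  (∀ j → h (inject₁ j) ≡ h (suc j)) → ∀ i → h i ≡ h zero
shift-invariant⇒constant h h-shift zero = refl
shift-invariant⇒constant {n = suc n} h h-shift (suc i) =
  trans (sym (h-shift i)) (shift-invariant⇒constant (h ∘ inject₁) (h-shift ∘ inject₁) i)

module CycleMap (E : Graph) {n : ℕ} (vs : Fin (suc n) → ℕ) (vs-injective : Injective _≡_ _≡_ vs)
  (edges : ∀ i → E (vs (inject₁ i)) (vs (suc i))) (closing : E (vs (fromℕ n)) (vs zero)) where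

  successor-value : Config → {i : Fin (suc n)} → View i → Bool
  successor-value α ‵fromℕ = not (α (vs zero))
  successor-value α (‵inject₁ j) = α (vs (suc j))

  rotate : Config → Config
  rotate α v with any? (λ i → vs i ≟ v)
  ... | yes (i , _) = successor-value α (view i)
  ... | no _ = false

  rotate-respects : Respects E rotate
  rotate-respects v α β α≈β with any? (λ i → vs i ≟ v)
  ... | yes (i , refl) = successor-value-respects (view i) α≈β
    where
    successor-value-respects : ∀ {k} (w : View k) → (∀ x → E (vs k) x → α x ≡ β x) →
      successor-value α w ≡ successor-value β w
    successor-value-respects ‵fromℕ α≈β = cong not (α≈β (vs zero) closing)
    successor-value-respects (‵inject₁ j) α≈β = α≈β (vs (suc j)) (edges j)
  ... | no _ = refl

  rotate-on-cycle : ∀ α i → rotate α (vs i) ≡ successor-value α (view i)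
  rotate-on-cycle α i with any? (λ k → vs k ≟ vs i)
  ... | yes (k , vsₖ≡vsᵢ) rewrite vs-injective vsₖ≡vsᵢ = refl
  ... | no ∄k = ⊥-elim (∄k (i , refl))

  rotate-has-no-fixed-point : ¬ (Σ Config λ α → FixedPoint rotate α)
  rotate-has-no-fixed-point (α , fixed) = not-¬ refl (sym (begin
    not (α (vs zero))                        ≡⟨ cong (successor-value α) (sym (view-fromℕ n)) ⟩
    successor-value α (view (fromℕ n))       ≡⟨ sym (rotate-on-cycle α (fromℕ n)) ⟩
    rotate α (vs (fromℕ n))                  ≡⟨ fixed (vs (fromℕ n)) ⟩
    α (vs (fromℕ n))                         ≡⟨ shift-invariant⇒constant (α ∘ vs) copies (fromℕ n) ⟩
    α (vs zero)                              ∎))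
    where
    open ≡-Reasoning
    copies : ∀ j → α (vs (inject₁ j)) ≡ α (vs (suc j))
    copies j = begin
      α (vs (inject₁ j))                     ≡⟨ sym (fixed (vs (inject₁ j))) ⟩
      rotate α (vs (inject₁ j))              ≡⟨ rotate-on-cycle α (inject₁ j) ⟩
      successor-value α (view (inject₁ j))   ≡⟨ cong (successor-value α) (view-inject₁ j) ⟩
      α (vs (suc j))                         ∎

cycle⇒dangerous : (E : Graph) → HasDirectedCycle E → Dangerous E
cycle⇒dangerous E (n , vs , vs-injective , edges , closing) =
  rotate , rotate-respects , rotate-has-no-fixed-point
  where open CycleMap E vs vs-injective edges closing

Walk : Graph → ℕ → (ℕ → ℕ) → Set
Walk E k u = ∀ i → i < k → E (u i) (u (suc i))

module _ {E : Graph} where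

  walk-take : ∀ {j k u} → j ≤ k → Walk E k u → Walk E j u
  walk-take j≤k walk i i<j = walk i (<-≤-trans i<j j≤k)

  walk-drop : ∀ p {k u} → Walk E (p + k) u → Walk E k (λ i → u (p + i))
  walk-drop p {u = u} walk i i<k =
    subst (E (u (p + i)) ∘ u) (sym (+-suc p i)) (walk (p + i) (+-monoʳ-< p i<k))

  repeat⇒closed-walk : ∀ {p q u} → Walk E q u → p < q → u p ≡ u q →
    Σ ℕ λ n → p + suc n ≡ q × Walk E (suc n) (λ i → u (p + i)) × u (p + suc n) ≡ u (p + 0)
  repeat⇒closed-walk {p} {u = u} walk p<q uₚ≡u_q with n , refl ← m≤n⇒∃[o]m+o≡n p<q =
    n , +-suc p n , walk-drop p (subst (λ q → Walk E q u) (sym (+-suc p n)) walk) ,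
    trans (cong u (+-suc p n)) (trans (sym uₚ≡u_q) (cong u (sym (+-identityʳ p))))

  module _ (lem : ExcludedMiddle 0ℓ) where

    closed-walk⇒cycle : ∀ n u → Walk E (suc n) u → u (suc n) ≡ u 0 → HasDirectedCycle E
    closed-walk⇒cycle = <-rec ClosesCycle step
      where
      ClosesCycle : ℕ → Set
      ClosesCycle n = ∀ u → Walk E (suc n) u → u (suc n) ≡ u 0 → HasDirectedCycle E

      step : ∀ n → (∀ {m} → m < n → ClosesCycle m) → ClosesCycle n
      step n shorter u walk closed with lem {Σ ℕ λ i → Σ ℕ λ j → i < j × j ≤ n × u i ≡ u j}
      ... | yes (i , j , i<j , j≤n , uᵢ≡uⱼ)
        with m , i+1+m≡j , walk′ , closed′ ← repeat⇒closed-walk (walk-take (m≤n⇒m≤1+n j≤n) walk) i<j uᵢ≡uⱼ =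
        shorter (≤-trans (≤-trans (m≤n+m (suc m) i) (≤-reflexive i+1+m≡j)) j≤n) _ walk′ closed′
      ... | no no-repetition = n , u ∘ toℕ , distinct , edges , closing
        where
        distinct : Injective _≡_ _≡_ (u ∘ toℕ)
        distinct {i} {j} uᵢ≡uⱼ with <-cmp (toℕ i) (toℕ j)
        ... | tri< i<j _ _ = ⊥-elim (no-repetition (toℕ i , toℕ j , i<j , toℕ≤pred[n] j , uᵢ≡uⱼ))
        ... | tri≈ _ i≡j _ = toℕ-injective i≡j
        ... | tri> _ _ j<i = ⊥-elim (no-repetition (toℕ j , toℕ i , j<i , toℕ≤pred[n] i , sym uᵢ≡uⱼ))
        edges : ∀ i → E (u (toℕ (inject₁ i))) (u (suc (toℕ i)))
        edges i rewrite toℕ-inject₁ i = walk (toℕ i) (m<n⇒m<1+n (toℕ<n i))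
        closing : E (u (toℕ (fromℕ n))) (u 0)
        closing rewrite toℕ-fromℕ n = subst (E (u n)) closed (walk n (n<1+n n))

    repeat⇒cycle : ∀ {p q u} → Walk E q u → p < q → u p ≡ u q → HasDirectedCycle E
    repeat⇒cycle walk p<q uₚ≡u_q with n , _ , walk′ , closed ← repeat⇒closed-walk walk p<q uₚ≡u_q =
      closed-walk⇒cycle n _ walk′ closed

    bounded-walk⇒cycle : ∀ {M u} → Walk E M u → (∀ i → i ≤ M → u i < M) → HasDirectedCycle E
    bounded-walk⇒cycle {M} {u} walk bounded
      with i , j , i<j , same ← pigeonhole (n<1+n M) (λ i → fromℕ< (bounded (toℕ i) (toℕ≤pred[n] i))) =
      repeat⇒cycle (walk-take (toℕ≤pred[n] j) walk) i<j
        (trans (sym (toℕ-fromℕ< _)) (trans (cong toℕ same) (toℕ-fromℕ< _)))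

FixedBelow : (Config → Config) → ℕ → Config → Set
FixedBelow f M α = ∀ v → v < M → f α v ≡ α v

FixedBelow-antitone : ∀ {f M N α} → M ≤ N → FixedBelow f N α → FixedBelow f M α
FixedBelow-antitone M≤N fixed v v<M = fixed v (<-≤-trans v<M M≤N)

module Iteration (lem : ExcludedMiddle 0ℓ) {E : Graph} (acyclic : ¬ HasDirectedCycle E)
  {g : Config → Config} (g-respects : Respects E g) where

  Changed : ℕ → ℕ → Set
  Changed t v = fold ∅ g (suc t) v ≢ fold ∅ g t v

  changed-successor : ∀ t {v} → Changed (suc t) v → Σ ℕ λ w → E v w × Changed t w
  changed-successor t changed = em⇒dne lem λ none →
    changed (g-respects _ _ _ λ w e → decidable-stable (_ ≟ᵇ _) λ changed-w → none (w , e , changed-w))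

  module _ {M : ℕ} (vanishes : ∀ α v → M ≤ v → g α v ≡ false) where

    changed⇒< : ∀ t {v} → Changed t v → v < M
    changed⇒< t {v} changed = decidable-stable (v <? M) λ v≮M →
      changed (trans (iterate-vanishes (suc t) (≮⇒≥ v≮M)) (sym (iterate-vanishes t (≮⇒≥ v≮M))))
      where
      iterate-vanishes : ∀ t → M ≤ v → fold ∅ g t v ≡ false
      iterate-vanishes zero M≤v = refl
      iterate-vanishes (suc t) M≤v = vanishes _ v M≤v

    changed⇒walk : ∀ t {v} → Changed t v → Σ (ℕ → ℕ) λ u → u 0 ≡ v × Walk E t u × (∀ i → u i < M)
    changed⇒walk zero changed = (λ _ → _) , refl , (λ _ ()) , (λ _ → changed⇒< zero changed)
    changed⇒walk (suc t) {v} changed with w , e , changed-w ← changed-successor t changed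
      with u , u₀≡w , walk , bounded ← changed⇒walk t changed-w = v◂u , refl , walk′ , bounded′
      where
      v◂u : ℕ → ℕ
      v◂u zero = v
      v◂u (suc i) = u i
      walk′ : Walk E (suc t) v◂u
      walk′ zero _ = subst (E v) (sym u₀≡w) e
      walk′ (suc i) i<t = walk i (s≤s⁻¹ i<t)
      bounded′ : ∀ i → v◂u i < M
      bounded′ zero = changed⇒< (suc t) changed
      bounded′ (suc i) = bounded i

    iterate-fixed : FixedPoint g (fold ∅ g M)
    iterate-fixed v = decidable-stable (_ ≟ᵇ _) λ changed →
      let u , _ , walk , bounded = changed⇒walk M changed
      in acyclic (bounded-walk⇒cycle {E} lem walk (λ i _ → bounded i))

truncate : ℕ → (Config → Config) → Config → Config
truncate M f α v with v <? M
... | yes _ = f α v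
... | no _ = false

module _ {M : ℕ} {f : Config → Config} where

  truncate-< : ∀ α {v} → v < M → truncate M f α v ≡ f α v
  truncate-< α {v} v<M with v <? M
  ... | yes _ = refl
  ... | no v≮M = ⊥-elim (v≮M v<M)

  truncate-≥ : ∀ α v → M ≤ v → truncate M f α v ≡ false
  truncate-≥ α v M≤v with v <? M
  ... | yes v<M = ⊥-elim (≤⇒≯ M≤v v<M)
  ... | no _ = refl

  truncate-respects : ∀ {E} → Respects E f → Respects E (truncate M f)
  truncate-respects f-respects v α β α≈β with v <? M
  ... | yes _ = f-respects v α β α≈β
  ... | no _ = refl

acyclic⇒fixed-below : ExcludedMiddle 0ℓ → ∀ {E f} → ¬ HasDirectedCycle E → Respects E f →
  ∀ M → Σ Config (FixedBelow f M)
acyclic⇒fixed-below lem {f = f} acyclic f-respects M =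
  fold ∅ (truncate M f) M , λ v v<M → trans (sym (truncate-< _ v<M)) (iterate-fixed (truncate-≥ {M}) v)
  where open Iteration lem acyclic (truncate-respects {M} f-respects)

_≈[_]_ : Config → ℕ → Config → Set
α ≈[ k ] β = ∀ i → i < k → α i ≡ β i

_[_≔_] : Config → ℕ → Bool → Config
(α [ k ≔ b ]) i with i ≟ k
... | yes _ = b
... | no _ = α i

[≔]-≢ : ∀ α {k b i} → i ≢ k → (α [ k ≔ b ]) i ≡ α i
[≔]-≢ α {k} {i = i} i≢k with i ≟ k
... | yes i≡k = ⊥-elim (i≢k i≡k)
... | no _ = refl

≈-extend : ∀ {α β k} → α ≈[ k ] β → ∀ {b} → α k ≡ b → α ≈[ suc k ] (β [ k ≔ b ])
≈-extend {k = k} α≈β αₖ≡b i i<1+k with i ≟ k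
... | yes refl = αₖ≡b
... | no i≢k = α≈β i (≤∧≢⇒< (s≤s⁻¹ i<1+k) i≢k)

module Compactness (lem : ExcludedMiddle 0ℓ) (P : ℕ → Config → Set)
  (P-antitone : ∀ {M N α} → M ≤ N → P N α → P M α) (P-inhabited : ∀ M → Σ Config (P M)) where

  ¬∀⇒∃¬ : {Q : ℕ → Set} → ¬ (∀ M → Q M) → Σ ℕ λ M → ¬ Q M
  ¬∀⇒∃¬ ¬all = dne λ none → ¬all λ M → dne λ ¬Q → none (M , ¬Q)
    where dne = em⇒dne lem

  Extendable : ℕ → Config → Set
  Extendable k α = ∀ M → Σ Config λ β → β ≈[ k ] α × P M β

  extend-false : ∀ {k α} → Extendable k α → ¬ Extendable (suc k) (α [ k ≔ true ]) →
    Extendable (suc k) (α [ k ≔ false ])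
  extend-false {k} {α} extendable stuck M with M₀ , stuck₀ ← ¬∀⇒∃¬ stuck
    with β , β≈α , Pβ ← extendable (M ⊔ M₀) | β k in βₖ
  ... | true = ⊥-elim (stuck₀ (β , ≈-extend β≈α βₖ , P-antitone (m≤n⊔m M M₀) Pβ))
  ... | false = β , ≈-extend β≈α βₖ , P-antitone (m≤m⊔n M M₀) Pβ

  choose : ℕ → Config → Bool
  choose k α with lem {Extendable (suc k) (α [ k ≔ true ])}
  ... | yes _ = true
  ... | no _ = false

  extend-chosen : ∀ {k α} → Extendable k α → Extendable (suc k) (α [ k ≔ choose k α ])
  extend-chosen {k} {α} extendable with lem {Extendable (suc k) (α [ k ≔ true ])}
  ... | yes extendable-true = extendable-true
  ... | no stuck = extend-false extendable stuck

  prefix : ℕ → Config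
  prefix zero = ∅
  prefix (suc k) = prefix k [ k ≔ choose k (prefix k) ]

  prefix-extendable : ∀ k → Extendable k (prefix k)
  prefix-extendable zero M with β , Pβ ← P-inhabited M = β , (λ _ ()) , Pβ
  prefix-extendable (suc k) = extend-chosen (prefix-extendable k)

  limit : Config
  limit i = prefix (suc i) i

  prefix≈limit : ∀ k → prefix k ≈[ k ] limit
  prefix≈limit (suc k) i i<1+k with m<1+n⇒m<n∨m≡n i<1+k
  ... | inj₁ i<k = trans ([≔]-≢ (prefix k) (<⇒≢ i<k)) (prefix≈limit k i i<k)
  ... | inj₂ refl = refl

weak-König : ExcludedMiddle 0ℓ → (P : ℕ → Config → Set) → (∀ {M N α} → M ≤ N → P N α → P M α) →
  (∀ M → Σ Config (P M)) → Σ Config λ α → ∀ k M → Σ Config λ β → β ≈[ k ] α × P M β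
weak-König lem P P-antitone P-inhabited = limit , λ k M →
  let β , β≈prefix , Pβ = prefix-extendable k M
  in β , (λ i i<k → trans (β≈prefix i i<k) (prefix≈limit k i i<k)) , Pβ
  where open Compactness lem P P-antitone P-inhabited

approximable⇒fixed-point : ∀ {E f α} → LocallyFinite E → Respects E f →
  (∀ k M → Σ Config λ β → β ≈[ k ] α × FixedBelow f M β) → FixedPoint f α
approximable⇒fixed-point {E} {f} {α} locally-finite f-respects approximable v =
  let β , β≈α , β-fixed = approximable K K in begin
    f α v ≡⟨ f-respects v α β (λ w e → sym (β≈α w (neighbour<K w e))) ⟩
    f β v ≡⟨ β-fixed v v<K ⟩
    β v   ≡⟨ β≈α v v<K ⟩
    α v   ∎
  where
  open ≡-Reasoning
  neighbours : List ℕ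
  neighbours = locally-finite v .proj₁
  K : ℕ
  K = suc (max v neighbours)
  v<K : v < K
  v<K = s≤s (v≤max⁺ v neighbours (inj₁ ≤-refl))
  neighbour<K : ∀ w → E v w → w < K
  neighbour<K w e = s≤s (All.lookup (xs≤max v neighbours) (Equivalence.to (locally-finite v .proj₂ w) e))

acyclic⇒fixed-point : ExcludedMiddle 0ℓ → ∀ {E f} → LocallyFinite E → ¬ HasDirectedCycle E →
  Respects E f → Σ Config (FixedPoint f)
acyclic⇒fixed-point lem {f = f} locally-finite acyclic f-respects =
  let α , approximable = weak-König lem (FixedBelow f) (FixedBelow-antitone {f})
                           (acyclic⇒fixed-below lem acyclic f-respects)
  in α , approximable⇒fixed-point locally-finite f-respects approximable

dangerous⇒cycle : ExcludedMiddle 0ℓ → (E : Graph) → LocallyFinite E → Dangerous E → HasDirectedCycle E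
dangerous⇒cycle lem E locally-finite (f , f-respects , no-fixed-point) =
  em⇒dne lem λ acyclic → no-fixed-point (acyclic⇒fixed-point lem locally-finite acyclic f-respects)

theorem3p3 : ExcludedMiddle 0ℓ → (E : Graph) → LocallyFinite E →
    (Dangerous E ⇔ HasDirectedCycle E)
theorem3p3 lem E locally-finite = mk⇔ (dangerous⇒cycle lem E locally-finite) (cycle⇒dangerous E)
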